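{- Let $G=(V,E)$ be a $P(2,1)$-graph that is not $K_2^3$ and has no vertex of degree $2$. Then there exist a vertex $v$ of degree $3$ and an edge $e$ not incident to $v$ such that $G-e$ is $(2,2)$-tight.
   Context: Graphs are finite multigraphs, loops allowed; a loop contributes $2$ to the degree of its vertex. $K_2^3$ denotes the graph on two vertices with three parallel edges between them. A graph is $(k,\ell)$-sparse if every subgraph $(V',E')$ with at least one edge has $|E'|\le k|V'|-\ell$, and $(k,\ell)$-tight if also $|E|=k|V|-\ell$. A $P(2,1)$-graph is a $(2,1)$-tight graph $G$ such that $G-e$ is $(2,2)$-tight for some edge $e$. -}

module Defs where

open import Data.Nat using (ℕ; zero; suc; _+_; _*_; _≤_)
open import Data.Fin using (Fin; _≟_)
open import Data.Fin.Subset using (Subset; _∈_; ∣_∣; Nonempty)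
open import Data.List using (List; length; lookup; removeAt; map)
open import Data.Nat.ListAction using (sum)
open import Data.Product using (_×_; _,_; proj₁; proj₂; Σ; ∃)
open import Relation.Binary.PropositionalEquality using (_≡_; _≢_)
open import Relation.Nullary.Decidable using (⌊_⌋)
open import Data.Bool using (if_then_else_)

-- A finite multigraph (loops allowed): n vertices Fin n, and a list of
-- edges, each given by its pair of endpoints. Parallel edges are repeated
-- list entries; a loop is a pair (v , v). Edges are identified by their
-- position in the list, i.e. by Fin (length es).
record Graph : Set where
  constructor mkGraph
  field
    n     : ℕ
    edges : List (Fin n × Fin n)
open Graph public

#E : Graph → ℕ
#E G = length (edges G)

Edge : Graph → Set
Edge G = Fin (#E G)

endpoints : (G : Graph) → Edge G → Fin (n G) × Fin (n G)
endpoints G e = lookup (edges G) e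

_-ₑ_ : (G : Graph) → Edge G → Graph
G -ₑ e = mkGraph (n G) (removeAt (edges G) e)

-- degree: number of edge-ends at v (a loop contributes 2)
ends : ∀ {k} → Fin k → Fin k × Fin k → ℕ
ends v (a , b) = (if ⌊ a ≟ v ⌋ then 1 else 0) + (if ⌊ b ≟ v ⌋ then 1 else 0)

degree : (G : Graph) → Fin (n G) → ℕ
degree G v = sum (map (ends v) (edges G))

Incident : (G : Graph) → Fin (n G) → Edge G → Set
Incident G v e = (proj₁ (endpoints G e) ≡ v) Data.Sum.⊎ (proj₂ (endpoints G e) ≡ v)
  where import Data.Sum

IsSubgraph : (G : Graph) → Subset (n G) → Subset (#E G) → Set
IsSubgraph G V' E' = ∀ e → e ∈ E' → (proj₁ (endpoints G e) ∈ V') × (proj₂ (endpoints G e) ∈ V')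

-- (k,ℓ)-sparse: every subgraph with at least one edge has |E'| ≤ k|V'| - ℓ
-- (stated over ℕ as |E'| + ℓ ≤ k|V'|, equivalent to the integer inequality)
Sparse : ℕ → ℕ → Graph → Set
Sparse k ℓ G = (V' : Subset (n G)) (E' : Subset (#E G)) →
  IsSubgraph G V' E' → Nonempty E' → ∣ E' ∣ + ℓ ≤ k * ∣ V' ∣

Tight : ℕ → ℕ → Graph → Set
Tight k ℓ G = Sparse k ℓ G × (#E G + ℓ ≡ k * n G)

P21 : Graph → Set
P21 G = Tight 2 1 G × Σ (Edge G) (λ e → Tight 2 2 (G -ₑ e))

IsK23 : Graph → Set
IsK23 G = (n G ≡ 2) × (#E G ≡ 3) × (∀ e → proj₁ (endpoints G e) ≢ proj₂ (endpoints G e))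

Vertex : Graph → Set
Vertex G = Fin (n G)

module Submission where

-- Call a subgraph (V', E') with an edge tight if |E'| = 2|V'| - 1.  Every
-- tight subgraph contains e₀ (G - e₀ is (2,2)-sparse), and two tight
-- subgraphs sharing an edge meet in a tight subgraph (submodularity of the
-- counts, sparsity of the union).  So in a tight subgraph H with fewest
-- edges every edge e is removable: a (2,2)-violation in G - e would be a
-- tight subgraph avoiding e, meeting H in a smaller tight subgraph.
--
-- A cut lemma (a vertex set S is met by at least 2|S| edges, or by all of
-- them) gives minimum degree 2, hence 3, and the degree sum 4|V| - 2 then
-- gives a degree-3 vertex besides any given one.  Take an edge f = pq of H.
-- A degree-3 vertex off {p, q} works with f.  Otherwise p ≠ q both have
-- degree 3, and H (with ≥ 3 edges) has an edge missing p or q: if all its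
-- edges joined p and q, the cut lemma for {p, q} would force G = K₂³.

open import Defs
open import Data.Bool using (Bool; true; false; not; _∨_; if_then_else_)
import Data.Bool.Properties as Bool
open import Data.Empty using (⊥-elim)
open import Data.Fin using (Fin; zero; suc)
open import Data.Fin.Properties using (_≟_; any?; all?)
open import Data.Fin.Subset using (Subset; ⊤; _∈_; ∣_∣; Nonempty; _∪_; _∩_)
open import Data.Fin.Subset.Properties
  using (∈⊤; ∣⊤∣≡n; ∣p∣≤n; ∣p∣≡n⇒p≡⊤; p⊂q⇒∣p∣<∣q∣; p∩q⊆p; x∈p∩q⁺; x∈p∩q⁻; x∈p∪q⁺; x∈p∪q⁻;
         _∈?_; nonempty?; anySubset?)
open import Data.List using (List; []; _∷_; length; lookup; removeAt; map)
open import Data.List.Properties using (length-removeAt′)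
open import Data.Nat using (ℕ; zero; suc; _+_; _*_; _≤_; _<_; z≤n; s≤s; _≤?_; _<?_)
import Data.Nat as ℕ
open import Data.Nat.ListAction using (sum)
open import Data.Nat.Properties hiding (_≟_)
open import Algebra.Properties.CommutativeSemigroup +-commutativeSemigroup using (interchange; xy∙z≈xz∙y)
open import Data.Product using (_×_; Σ; _,_; proj₁; proj₂)
open import Data.Sum using (_⊎_; inj₁; inj₂; [_,_])
open import Data.Vec using ([]; _∷_; tabulate) renaming (lookup to _!_)
open import Data.Vec.Properties using (lookup∘tabulate; []=⇒lookup; lookup⇒[]=)
open import Function using (_∘_)
open import Relation.Binary.PropositionalEquality
  using (_≡_; _≢_; refl; sym; trans; cong; cong₂; subst; subst₂; module ≡-Reasoning)
open import Relation.Nullary using (¬_; Dec; yes; no; ¬?)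
open import Relation.Nullary.Decidable using (⌊_⌋; _×-dec_; _⊎-dec_; _→-dec_; map′; decidable-stable)

𝟙 : Bool → ℕ
𝟙 b = if b then 1 else 0

𝟙-∨ : ∀ x y → 𝟙 (x ∨ y) ≤ 𝟙 x + 𝟙 y
𝟙-∨ true y = s≤s z≤n
𝟙-∨ false y = ≤-refl

𝟙≤1 : ∀ b → 𝟙 b ≤ 1
𝟙≤1 true = ≤-refl
𝟙≤1 false = z≤n

ΣF : ∀ {k} → (Fin k → ℕ) → ℕ
ΣF {zero} f = 0
ΣF {suc k} f = f zero + ΣF (f ∘ suc)

ΣF-cong : ∀ {k} {f g : Fin k → ℕ} → (∀ i → f i ≡ g i) → ΣF f ≡ ΣF g
ΣF-cong {zero} h = refl
ΣF-cong {suc k} h = cong₂ _+_ (h zero) (ΣF-cong (h ∘ suc))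

ΣF-mono : ∀ {k} {f g : Fin k → ℕ} → (∀ i → f i ≤ g i) → ΣF f ≤ ΣF g
ΣF-mono {zero} h = z≤n
ΣF-mono {suc k} h = +-mono-≤ (h zero) (ΣF-mono (h ∘ suc))

ΣF-+ : ∀ {k} (f g : Fin k → ℕ) → ΣF (λ i → f i + g i) ≡ ΣF f + ΣF g
ΣF-+ {zero} f g = refl
ΣF-+ {suc k} f g rewrite ΣF-+ (f ∘ suc) (g ∘ suc) = interchange (f zero) (g zero) _ _

ΣF-const : ∀ {k} c → ΣF {k} (λ _ → c) ≡ k * c
ΣF-const {zero} c = refl
ΣF-const {suc k} c = cong (c +_) (ΣF-const {k} c)

ΣF-swap : ∀ {k l} (f : Fin k → Fin l → ℕ) →
  ΣF (λ i → ΣF (λ j → f i j)) ≡ ΣF (λ j → ΣF (λ i → f i j))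
ΣF-swap {zero} {l} f = sym (trans (ΣF-const {l} 0) (*-zeroʳ l))
ΣF-swap {suc k} f = trans (cong (ΣF (f zero) +_) (ΣF-swap (f ∘ suc)))
  (sym (ΣF-+ (f zero) (λ j → ΣF (λ i → f (suc i) j))))

ΣF-single : ∀ {k} (f : Fin k → ℕ) v → k ≡ 1 → ΣF f ≡ f v
ΣF-single f zero refl = +-identityʳ (f zero)

count : ∀ {k} → (Fin k → Bool) → ℕ
count P = ΣF (𝟙 ∘ P)

count-all : ∀ {k} (P : Fin k → Bool) → (∀ i → P i ≡ true) → count P ≡ k
count-all {k} P h = trans (ΣF-cong (λ i → cong 𝟙 (h i))) (trans (ΣF-const {k} 1) (*-identityʳ k))

count-complement : ∀ {k} (P : Fin k → Bool) → count (not ∘ P) + count P ≡ k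
count-complement {k} P = begin
    count (not ∘ P) + count P        ≡⟨ ΣF-+ (𝟙 ∘ not ∘ P) (𝟙 ∘ P) ⟨
    ΣF (λ i → 𝟙 (not (P i)) + 𝟙 (P i)) ≡⟨ ΣF-cong (λ i → one (P i)) ⟩
    ΣF {k} (λ _ → 1)                 ≡⟨ trans (ΣF-const {k} 1) (*-identityʳ k) ⟩
    k                                ∎
  where
  open ≡-Reasoning
  one : ∀ b → 𝟙 (not b) + 𝟙 b ≡ 1
  one true = refl
  one false = refl

≟-suc : ∀ {k} (a b : Fin k) → ⌊ suc a ≟ suc b ⌋ ≡ ⌊ a ≟ b ⌋
≟-suc a b with a ≟ b
... | yes _ = refl
... | no _ = refl

≟-refl : ∀ {k} (a : Fin k) → ⌊ a ≟ a ⌋ ≡ true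
≟-refl a with a ≟ a
... | yes _ = refl
... | no a≢a = ⊥-elim (a≢a refl)

≟-sym : ∀ {k} (a b : Fin k) → ⌊ a ≟ b ⌋ ≡ ⌊ b ≟ a ⌋
≟-sym a b with a ≟ b | b ≟ a
... | yes _ | yes _ = refl
... | no _ | no _ = refl
... | yes p | no ¬q = ⊥-elim (¬q (sym p))
... | no ¬p | yes q = ⊥-elim (¬p (sym q))

count-singleton : ∀ {k} (a : Fin k) → count (λ i → ⌊ i ≟ a ⌋) ≡ 1
count-singleton {suc k} zero = cong suc (trans (ΣF-const {k} 0) (*-zeroʳ k))
count-singleton {suc k} (suc a) =
  trans (ΣF-cong (λ i → cong 𝟙 (≟-suc i a))) (count-singleton a)

count-two : ∀ {k} (P : Fin k → Bool) {p q} → p ≢ q → P p ≡ true → P q ≡ true →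
  2 ≤ count P
count-two P {p} {q} p≢q Pp Pq = begin
    2                                               ≡⟨ cong₂ _+_ (count-singleton p) (count-singleton q) ⟨
    count (λ i → ⌊ i ≟ p ⌋) + count (λ i → ⌊ i ≟ q ⌋) ≡⟨ ΣF-+ (λ i → 𝟙 ⌊ i ≟ p ⌋) (λ i → 𝟙 ⌊ i ≟ q ⌋) ⟨
    ΣF (λ i → 𝟙 ⌊ i ≟ p ⌋ + 𝟙 ⌊ i ≟ q ⌋)            ≤⟨ ΣF-mono pointwise ⟩
    count P                                         ∎
  where
  open ≤-Reasoning
  pointwise : ∀ i → 𝟙 ⌊ i ≟ p ⌋ + 𝟙 ⌊ i ≟ q ⌋ ≤ 𝟙 (P i)
  pointwise i with i ≟ p | i ≟ q
  ... | yes refl | yes refl = ⊥-elim (p≢q refl)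
  ... | yes refl | no _ = ≤-reflexive (cong 𝟙 (sym Pp))
  ... | no _ | yes refl = ≤-reflexive (cong 𝟙 (sym Pq))
  ... | no _ | no _ = z≤n

true≢false : true ≢ false
true≢false ()

∈⇒! : ∀ {k} {i : Fin k} {s : Subset k} → i ∈ s → s ! i ≡ true
∈⇒! = []=⇒lookup

!⇒∈ : ∀ {k} {i : Fin k} {s : Subset k} → s ! i ≡ true → i ∈ s
!⇒∈ {i = i} {s} = lookup⇒[]= i s

∉⇒! : ∀ {k} {i : Fin k} {s : Subset k} → ¬ (i ∈ s) → s ! i ≡ false
∉⇒! {i = i} {s} i∉s with s ! i in eq
... | true = ⊥-elim (i∉s (!⇒∈ eq))
... | false = refl

neither : ∀ x y → not (x ∨ y) ≡ true → (not x ≡ true) × (not y ≡ true)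
neither false false refl = refl , refl

∈-tabulate⁺ : ∀ {k} {P : Fin k → Bool} {i} → P i ≡ true → i ∈ tabulate P
∈-tabulate⁺ {P = P} {i} h = !⇒∈ (trans (lookup∘tabulate P i) h)

∈-tabulate⁻ : ∀ {k} {P : Fin k → Bool} {i} → i ∈ tabulate P → P i ≡ true
∈-tabulate⁻ {P = P} {i} h = trans (sym (lookup∘tabulate P i)) (∈⇒! h)

∣∣-count : ∀ {k} (s : Subset k) → ∣ s ∣ ≡ count (s !_)
∣∣-count [] = refl
∣∣-count (true ∷ s) = cong suc (∣∣-count s)
∣∣-count (false ∷ s) = ∣∣-count s

∣tabulate∣ : ∀ {k} (P : Fin k → Bool) → ∣ tabulate P ∣ ≡ count P
∣tabulate∣ P = trans (∣∣-count (tabulate P)) (ΣF-cong (λ i → cong 𝟙 (lookup∘tabulate P i)))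

∣∪∣+∣∩∣ : ∀ {k} (p q : Subset k) → ∣ p ∪ q ∣ + ∣ p ∩ q ∣ ≡ ∣ p ∣ + ∣ q ∣
∣∪∣+∣∩∣ [] [] = refl
∣∪∣+∣∩∣ (true ∷ p) (true ∷ q) =
  cong suc (trans (+-suc _ _) (trans (cong suc (∣∪∣+∣∩∣ p q)) (sym (+-suc _ _))))
∣∪∣+∣∩∣ (true ∷ p) (false ∷ q) = cong suc (∣∪∣+∣∩∣ p q)
∣∪∣+∣∩∣ (false ∷ p) (true ∷ q) = trans (cong suc (∣∪∣+∣∩∣ p q)) (sym (+-suc _ _))
∣∪∣+∣∩∣ (false ∷ p) (false ∷ q) = ∣∪∣+∣∩∣ p q

minimise : {A : Set} (P : A → Set) (μ : A → ℕ) →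
  (∀ k → Dec (Σ A λ a → P a × μ a < k)) →
  ∀ a → P a → Σ A λ b → P b × (∀ c → P c → μ b ≤ μ c)
minimise {A} P μ below? a Pa = descend (μ a) a Pa ≤-refl
  where
  descend : ∀ bound a → P a → μ a ≤ bound → Σ A λ b → P b × (∀ c → P c → μ b ≤ μ c)
  descend bound a Pa μa≤bound with below? (μ a)
  ... | no none = a , Pa , λ c Pc → ≮⇒≥ (λ μc<μa → none (c , Pc , μc<μa))
  descend zero a Pa μa≤0 | yes (b , Pb , μb<μa) = ⊥-elim (n≮0 (≤-trans μb<μa μa≤0))
  descend (suc bound) a Pa μa≤bound | yes (b , Pb , μb<μa) =
    descend bound b Pb (≤-pred (≤-trans μb<μa μa≤bound))

2≰1 : ¬ (2 ≤ 1)
2≰1 (s≤s ())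

-- The counting behind submodularity: if two edge sets are dense (2c ≤ a + 1,
-- 2d ≤ b + 1) and their union sparse (u + 1 ≤ 2U), modularity of cardinalities
-- makes the intersection dense.
submodular-count : ∀ {a b c d u i U I} → 2 * c ≤ a + 1 → 2 * d ≤ b + 1 → u + 1 ≤ 2 * U →
  u + i ≡ a + b → U + I ≡ c + d → 2 * I ≤ i + 1
submodular-count {a} {b} {c} {d} {u} {i} {U} {I} dense-c dense-d sparse-U edges vertices =
  +-cancelˡ-≤ (2 * U) (2 * I) (i + 1) (begin
    2 * U + 2 * I          ≡⟨ *-distribˡ-+ 2 U I ⟨
    2 * (U + I)            ≡⟨ cong (2 *_) vertices ⟩
    2 * (c + d)            ≡⟨ *-distribˡ-+ 2 c d ⟩
    2 * c + 2 * d          ≤⟨ +-mono-≤ dense-c dense-d ⟩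
    (a + 1) + (b + 1)      ≡⟨ interchange a 1 b 1 ⟩
    (a + b) + 2            ≡⟨ cong (_+ 2) edges ⟨
    (u + i) + 2            ≡⟨ interchange u 1 i 1 ⟨
    (u + 1) + (i + 1)      ≤⟨ +-monoˡ-≤ (i + 1) sparse-U ⟩
    2 * U + (i + 1)        ∎)
  where open ≤-Reasoning

degree-ΣF : (G : Graph) (v : Vertex G) → degree G v ≡ ΣF (λ e → ends v (endpoints G e))
degree-ΣF G v = sum-map (edges G)
  where
  sum-map : (es : List (Fin (n G) × Fin (n G))) →
    sum (map (ends v) es) ≡ ΣF (λ i → ends v (lookup es i))
  sum-map [] = refl
  sum-map (x ∷ es) = cong (ends v x +_) (sum-map es)

handshake : (G : Graph) → ΣF (degree G) ≡ #E G * 2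
handshake G = begin
    ΣF (degree G)                                    ≡⟨ ΣF-cong (degree-ΣF G) ⟩
    ΣF (λ v → ΣF (λ e → ends v (endpoints G e)))      ≡⟨ ΣF-swap (λ v e → ends v (endpoints G e)) ⟩
    ΣF (λ e → ΣF (λ v → ends v (endpoints G e)))      ≡⟨ ΣF-cong (two-ends ∘ endpoints G) ⟩
    ΣF {#E G} (λ _ → 2)                              ≡⟨ ΣF-const {#E G} 2 ⟩
    #E G * 2                                         ∎
  where
  open ≡-Reasoning
  one-end : (a : Vertex G) → ΣF (λ v → 𝟙 ⌊ a ≟ v ⌋) ≡ 1
  one-end a = trans (ΣF-cong (λ v → cong 𝟙 (≟-sym a v))) (count-singleton a)
  two-ends : (ab : Vertex G × Vertex G) → ΣF (λ v → ends v ab) ≡ 2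
  two-ends (a , b) = trans (ΣF-+ (λ v → 𝟙 ⌊ a ≟ v ⌋) (λ v → 𝟙 ⌊ b ≟ v ⌋))
                           (cong₂ _+_ (one-end a) (one-end b))

incident? : (G : Graph) (v : Vertex G) (e : Edge G) → Dec (Incident G v e)
incident? G v e = (proj₁ (endpoints G e) ≟ v) ⊎-dec (proj₂ (endpoints G e) ≟ v)

incident⇒end : ∀ {k} {v a b : Fin k} → (a ≡ v) ⊎ (b ≡ v) → 1 ≤ ends v (a , b)
incident⇒end {v = v} (inj₁ refl) with v ≟ v
... | yes _ = s≤s z≤n
... | no v≢v = ⊥-elim (v≢v refl)
incident⇒end {v = v} {a} (inj₂ refl) with v ≟ v
... | yes _ = m≤n+m 1 (𝟙 ⌊ a ≟ v ⌋)
... | no v≢v = ⊥-elim (v≢v refl)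

meets-pair≤ends : ∀ {k} (p q a b : Fin k) →
  𝟙 ((⌊ a ≟ p ⌋ ∨ ⌊ a ≟ q ⌋) ∨ (⌊ b ≟ p ⌋ ∨ ⌊ b ≟ q ⌋)) ≤ ends p (a , b) + ends q (a , b)
meets-pair≤ends p q a b = begin
    𝟙 ((⌊ a ≟ p ⌋ ∨ ⌊ a ≟ q ⌋) ∨ (⌊ b ≟ p ⌋ ∨ ⌊ b ≟ q ⌋))
  ≤⟨ 𝟙-∨ (⌊ a ≟ p ⌋ ∨ ⌊ a ≟ q ⌋) _ ⟩
    𝟙 (⌊ a ≟ p ⌋ ∨ ⌊ a ≟ q ⌋) + 𝟙 (⌊ b ≟ p ⌋ ∨ ⌊ b ≟ q ⌋)
  ≤⟨ +-mono-≤ (𝟙-∨ ⌊ a ≟ p ⌋ _) (𝟙-∨ ⌊ b ≟ p ⌋ _) ⟩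
    (𝟙 ⌊ a ≟ p ⌋ + 𝟙 ⌊ a ≟ q ⌋) + (𝟙 ⌊ b ≟ p ⌋ + 𝟙 ⌊ b ≟ q ⌋)
  ≡⟨ interchange (𝟙 ⌊ a ≟ p ⌋) _ _ _ ⟩
    ends p (a , b) + ends q (a , b)
  ∎
  where open ≤-Reasoning

-- Deleting position i of a list: the surviving positions embed into the old
-- ones, and subsets of surviving positions correspond to subsets of old
-- positions that avoid i (extend / restrict), preserving cardinality.
module Deletion {A : Set} where

  Pos : List A → Set
  Pos xs = Fin (length xs)

  survivor : (xs : List A) (i : Pos xs) → Pos (removeAt xs i) → Pos xs
  survivor (x ∷ xs) zero j = suc j
  survivor (x ∷ xs) (suc i) zero = zero
  survivor (x ∷ xs) (suc i) (suc j) = suc (survivor xs i j)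

  lookup-survivor : (xs : List A) (i : Pos xs) (j : Pos (removeAt xs i)) →
    lookup (removeAt xs i) j ≡ lookup xs (survivor xs i j)
  lookup-survivor (x ∷ xs) zero j = refl
  lookup-survivor (x ∷ xs) (suc i) zero = refl
  lookup-survivor (x ∷ xs) (suc i) (suc j) = lookup-survivor xs i j

  survivor-onto : (xs : List A) (i : Pos xs) (k : Pos xs) → k ≢ i →
    Σ (Pos (removeAt xs i)) (λ j → survivor xs i j ≡ k)
  survivor-onto (x ∷ xs) zero zero k≢i = ⊥-elim (k≢i refl)
  survivor-onto (x ∷ xs) zero (suc k) k≢i = k , refl
  survivor-onto (x ∷ xs) (suc i) zero k≢i = zero , refl
  survivor-onto (x ∷ xs) (suc i) (suc k) k≢i with survivor-onto xs i k (k≢i ∘ cong suc)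
  ... | j , eq = suc j , cong suc eq

  extend : (xs : List A) (i : Pos xs) → Subset (length (removeAt xs i)) → Subset (length xs)
  extend (x ∷ xs) zero s = false ∷ s
  extend (x ∷ xs) (suc i) (b ∷ s) = b ∷ extend xs i s

  extend-survivor : (xs : List A) (i : Pos xs) (s : Subset (length (removeAt xs i))) (j : Pos (removeAt xs i)) →
    extend xs i s ! survivor xs i j ≡ s ! j
  extend-survivor (x ∷ xs) zero s j = refl
  extend-survivor (x ∷ xs) (suc i) (b ∷ s) zero = refl
  extend-survivor (x ∷ xs) (suc i) (b ∷ s) (suc j) = extend-survivor xs i s j

  extend-deleted : (xs : List A) (i : Pos xs) (s : Subset (length (removeAt xs i))) →
    extend xs i s ! i ≡ false
  extend-deleted (x ∷ xs) zero s = refl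
  extend-deleted (x ∷ xs) (suc i) (b ∷ s) = extend-deleted xs i s

  ∣extend∣ : (xs : List A) (i : Pos xs) (s : Subset (length (removeAt xs i))) →
    ∣ extend xs i s ∣ ≡ ∣ s ∣
  ∣extend∣ (x ∷ xs) zero s = refl
  ∣extend∣ (x ∷ xs) (suc i) (true ∷ s) = cong suc (∣extend∣ xs i s)
  ∣extend∣ (x ∷ xs) (suc i) (false ∷ s) = ∣extend∣ xs i s

  extend⁻ : (xs : List A) (i : Pos xs) (s : Subset (length (removeAt xs i))) (k : Pos xs) →
    k ∈ extend xs i s → Σ (Pos (removeAt xs i)) (λ j → (survivor xs i j ≡ k) × j ∈ s)
  extend⁻ xs i s k k∈ with k ≟ i
  ... | yes refl = ⊥-elim (true≢false (trans (sym (∈⇒! k∈)) (extend-deleted xs i s)))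
  ... | no k≢i with survivor-onto xs i k k≢i
  ... | j , refl = j , refl , !⇒∈ (trans (sym (extend-survivor xs i s j)) (∈⇒! k∈))

  restrict : (xs : List A) (i : Pos xs) → Subset (length xs) → Subset (length (removeAt xs i))
  restrict (x ∷ xs) zero (b ∷ s) = s
  restrict (x ∷ xs) (suc i) (b ∷ s) = b ∷ restrict xs i s

  restrict-survivor : (xs : List A) (i : Pos xs) (s : Subset (length xs)) (j : Pos (removeAt xs i)) →
    restrict xs i s ! j ≡ s ! survivor xs i j
  restrict-survivor (x ∷ xs) zero (b ∷ s) j = refl
  restrict-survivor (x ∷ xs) (suc i) (b ∷ s) zero = refl
  restrict-survivor (x ∷ xs) (suc i) (b ∷ s) (suc j) = restrict-survivor xs i s j

  ∣restrict∣ : (xs : List A) (i : Pos xs) (s : Subset (length xs)) → s ! i ≡ false →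
    ∣ restrict xs i s ∣ ≡ ∣ s ∣
  ∣restrict∣ (x ∷ xs) zero (false ∷ s) _ = refl
  ∣restrict∣ (x ∷ xs) (suc i) (true ∷ s) h = cong suc (∣restrict∣ xs i s h)
  ∣restrict∣ (x ∷ xs) (suc i) (false ∷ s) h = ∣restrict∣ xs i s h

open Deletion

module EdgeDeletion (G : Graph) (e : Edge G) where

  survives : Edge (G -ₑ e) → Edge G
  survives = survivor (edges G) e

  endpoints-survives : ∀ j → endpoints (G -ₑ e) j ≡ endpoints G (survives j)
  endpoints-survives = lookup-survivor (edges G) e

  subgraph-extend : ∀ V E → IsSubgraph (G -ₑ e) V E → IsSubgraph G V (extend (edges G) e E)
  subgraph-extend V E sub k k∈ with extend⁻ (edges G) e E k k∈
  ... | j , refl , j∈ = subst (λ uv → (proj₁ uv ∈ V) × (proj₂ uv ∈ V)) (endpoints-survives j) (sub j j∈)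

  subgraph-restrict : ∀ V E → IsSubgraph G V E → IsSubgraph (G -ₑ e) V (restrict (edges G) e E)
  subgraph-restrict V E sub j j∈ =
    subst (λ uv → (proj₁ uv ∈ V) × (proj₂ uv ∈ V)) (sym (endpoints-survives j))
      (sub (survives j) (!⇒∈ (trans (sym (restrict-survivor (edges G) e E j)) (∈⇒! j∈))))

  nonempty-extend : ∀ E → Nonempty E → Nonempty (extend (edges G) e E)
  nonempty-extend E (j , j∈) = survives j , !⇒∈ (trans (extend-survivor (edges G) e E j) (∈⇒! j∈))

  nonempty-restrict : ∀ E k → k ∈ E → k ≢ e → Nonempty (restrict (edges G) e E)
  nonempty-restrict E k k∈ k≢e with survivor-onto (edges G) e k k≢e
  ... | j , refl = j , !⇒∈ (trans (restrict-survivor (edges G) e E j) (∈⇒! k∈))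

module TightGraph (G : Graph) (sparse : Sparse 2 1 G) (#edges : #E G + 1 ≡ 2 * n G) where

  meets : (Vertex G → Bool) → Edge G → Bool
  meets S e = S (proj₁ (endpoints G e)) ∨ S (proj₂ (endpoints G e))

  -- If some
  -- edge avoids S, the complement of S spans a subgraph, and (2,1)-sparsity of
  -- that subgraph against |E| = 2|V| - 1 leaves at least 2|S| edges for S.
  cut : (S : Vertex G → Bool) → (2 * count S ≤ count (meets S)) ⊎ (count (meets S) ≡ #E G)
  cut S with any? (λ e → Bool._≟_ (meets S e) false)
  ... | no none = inj₂ (count-all (meets S) (λ e → Bool.¬-not (none ∘ (e ,_)) ))
  ... | yes (e , avoids) = inj₁ (+-cancelˡ-≤ (2 * w) _ _ (begin
      2 * w + 2 * s   ≡⟨ *-distribˡ-+ 2 w s ⟨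
      2 * (w + s)     ≡⟨ cong (2 *_) (count-complement S) ⟩
      2 * n G         ≡⟨ sym #edges ⟩
      #E G + 1        ≡⟨ cong (_+ 1) (sym (count-complement (meets S))) ⟩
      o + t + 1       ≡⟨ xy∙z≈xz∙y o t 1 ⟩
      o + 1 + t       ≤⟨ +-monoˡ-≤ t (subst₂ (λ a b → a + 1 ≤ 2 * b) (∣tabulate∣ (not ∘ meets S)) (∣tabulate∣ (not ∘ S))
                           (sparse (tabulate (not ∘ S)) (tabulate (not ∘ meets S)) outside
                                   (e , ∈-tabulate⁺ (cong not avoids)))) ⟩
      2 * w + t       ∎))
    where
    open ≤-Reasoning
    w s o t : ℕ
    w = count (not ∘ S)
    s = count S
    o = count (not ∘ meets S)
    t = count (meets S)
    outside : IsSubgraph G (tabulate (not ∘ S)) (tabulate (not ∘ meets S))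
    outside e e∈ with neither (S (proj₁ (endpoints G e))) (S (proj₂ (endpoints G e))) (∈-tabulate⁻ e∈)
    ... | a∉S , b∉S = ∈-tabulate⁺ a∉S , ∈-tabulate⁺ b∉S

  has-vertex : 1 ≤ n G
  has-vertex = positive (n G) #edges
    where
    positive : ∀ N → #E G + 1 ≡ 2 * N → 1 ≤ N
    positive zero m+1≡0 = ⊥-elim (1+n≢0 (trans (+-comm 1 (#E G)) m+1≡0))
    positive (suc _) _ = s≤s z≤n

  only : Vertex G → Vertex G → Bool
  only v i = ⌊ i ≟ v ⌋

  meets-only≤degree : ∀ v → count (meets (only v)) ≤ degree G v
  meets-only≤degree v = subst (count (meets (only v)) ≤_) (sym (degree-ΣF G v))
    (ΣF-mono (λ e → 𝟙-∨ ⌊ proj₁ (endpoints G e) ≟ v ⌋ _))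

  -- Every vertex has degree at least 2: by the cut lemma for {v}, either two
  -- edges meet v, or all edges do; then either there are two edges, or G is a
  -- single vertex with a single edge, necessarily a loop.
  degree≥2 : ∀ v → 2 ≤ degree G v
  degree≥2 v = from-cut (cut (only v))
    where
    single-vertex : #E G ≤ 1 → 2 ≤ degree G v
    single-vertex m≤1 = begin
      2                ≤⟨ *-monoˡ-≤ 2 1≤m ⟩
      #E G * 2         ≡⟨ handshake G ⟨
      ΣF (degree G)    ≡⟨ ΣF-single (degree G) v N≡1 ⟩
      degree G v       ∎
      where
      open ≤-Reasoning
      N≡1 : n G ≡ 1
      N≡1 = ≤-antisym (*-cancelˡ-≤ 2 (subst (_≤ 2) #edges (+-monoˡ-≤ 1 m≤1))) has-vertex
      1≤m : 1 ≤ #E G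
      1≤m = ≤-reflexive (sym (+-cancelʳ-≡ 1 (#E G) 1 (trans #edges (cong (2 *_) N≡1))))
    from-cut : (2 * count (only v) ≤ count (meets (only v))) ⊎ (count (meets (only v)) ≡ #E G) →
      2 ≤ degree G v
    from-cut (inj₁ many) =
      ≤-trans (subst (λ c → 2 * c ≤ count (meets (only v))) (count-singleton v) many) (meets-only≤degree v)
    from-cut (inj₂ all) with 2 ≤? #E G
    ... | yes 2≤m = ≤-trans 2≤m (subst (_≤ degree G v) all (meets-only≤degree v))
    ... | no 2≰m = single-vertex (≤-pred (≰⇒> 2≰m))

  -- If all degrees are at least 3, then besides any vertex u there is another
  -- of degree exactly 3: otherwise the degree sum would be at least 4|V| - 1,
  -- but it is 2|E| = 4|V| - 2.
  another-degree-3 : (∀ v → 3 ≤ degree G v) → ∀ u → Σ (Vertex G) (λ v → v ≢ u × degree G v ≡ 3)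
  another-degree-3 degree≥3 u with any? (λ v → ¬? (v ≟ u) ×-dec (degree G v ℕ.≟ 3))
  ... | yes found = found
  ... | no none = ⊥-elim (2≰1 (+-cancelˡ-≤ (#E G * 2) 2 1 (begin
      #E G * 2 + 2      ≡⟨ *-distribʳ-+ 2 (#E G) 1 ⟨
      (#E G + 1) * 2    ≡⟨ cong (_* 2) #edges ⟩
      2 * n G * 2       ≡⟨ trans (cong (_* 2) (*-comm 2 (n G))) (*-assoc (n G) 2 2) ⟩
      n G * 4           ≡⟨ ΣF-const {n G} 4 ⟨
      ΣF {n G} (λ _ → 4) ≤⟨ ΣF-mono ≥4 ⟩
      ΣF (λ v → degree G v + 𝟙 ⌊ v ≟ u ⌋) ≡⟨ ΣF-+ (degree G) (λ v → 𝟙 ⌊ v ≟ u ⌋) ⟩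
      ΣF (degree G) + count (only u)     ≡⟨ cong₂ _+_ (handshake G) (count-singleton u) ⟩
      #E G * 2 + 1      ∎)))
    where
    open ≤-Reasoning
    ≥4 : ∀ v → 4 ≤ degree G v + 𝟙 ⌊ v ≟ u ⌋
    ≥4 v with v ≟ u
    ... | yes _ = +-monoˡ-≤ 1 (degree≥3 v)
    ... | no v≢u = subst (4 ≤_) (sym (+-identityʳ _))
                     (≤∧≢⇒< (degree≥3 v) (λ 3≡d → none (v , v≢u , sym 3≡d)))

  degree-3-beside : (∀ v → 3 ≤ degree G v) → ∀ p q →
    Σ (Vertex G) (λ v → v ≢ p × v ≢ q × degree G v ≡ 3) ⊎ (p ≢ q × degree G p ≡ 3 × degree G q ≡ 3)
  degree-3-beside degree≥3 p q with another-degree-3 degree≥3 p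
  ... | v , v≢p , dv with v ≟ q
  ...   | no v≢q = inj₁ (v , v≢p , v≢q , dv)
  ...   | yes refl with another-degree-3 degree≥3 v
  ...     | w , w≢v , dw with w ≟ p
  ...       | no w≢p = inj₁ (w , w≢p , w≢v , dw)
  ...       | yes refl = inj₂ ((λ w≡v → v≢p (sym w≡v)) , dw , dv)

  pair : Vertex G → Vertex G → Vertex G → Bool
  pair p q i = ⌊ i ≟ p ⌋ ∨ ⌊ i ≟ q ⌋

  -- Double counting at {p, q}: each edge meeting {p, q} has an end there, and
  -- each edge of F (joining p and q) has two.
  meets-pair+joins≤degrees : ∀ {p q} (F : Subset (#E G)) →
    (∀ e → e ∈ F → Incident G p e × Incident G q e) →
    count (meets (pair p q)) + ∣ F ∣ ≤ degree G p + degree G q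
  meets-pair+joins≤degrees {p} {q} F F-joins = begin
      count (meets S) + ∣ F ∣                ≡⟨ cong (count (meets S) +_) (∣∣-count F) ⟩
      count (meets S) + count (F !_)         ≡⟨ ΣF-+ (𝟙 ∘ meets S) (𝟙 ∘ (F !_)) ⟨
      ΣF (λ e → 𝟙 (meets S e) + 𝟙 (F ! e))   ≤⟨ ΣF-mono bound ⟩
      ΣF (λ e → ends-p e + ends-q e)         ≡⟨ ΣF-+ ends-p ends-q ⟩
      ΣF ends-p + ΣF ends-q                  ≡⟨ cong₂ _+_ (degree-ΣF G p) (degree-ΣF G q) ⟨
      degree G p + degree G q                ∎
    where
    open ≤-Reasoning
    S : Vertex G → Bool
    S = pair p q
    ends-p ends-q : Edge G → ℕ
    ends-p e = ends p (endpoints G e)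
    ends-q e = ends q (endpoints G e)
    bound : ∀ e → 𝟙 (meets S e) + 𝟙 (F ! e) ≤ ends-p e + ends-q e
    bound e with F ! e in e∈F
    ... | true = ≤-trans (+-monoˡ-≤ 1 (𝟙≤1 (meets S e)))
                   (+-mono-≤ (incident⇒end (proj₁ (F-joins e (!⇒∈ e∈F))))
                             (incident⇒end (proj₂ (F-joins e (!⇒∈ e∈F)))))
    ... | false = subst (_≤ ends-p e + ends-q e) (sym (+-identityʳ _))
                    (meets-pair≤ends p q (proj₁ (endpoints G e)) (proj₂ (endpoints G e)))

  -- Two distinct vertices of degree 3 joined by at least three parallel edges
  -- (the edges of F) make G equal to K₂³: these edges use up both degrees, so
  -- at most 3 < 2·|{p, q}| edges meet {p, q}; by the cut lemma every edge
  -- meets {p, q}, so |E| ≤ 3, whence |V| = 2, |E| = 3 and E = F is loop-free.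
  pair⇒K23 : ∀ {p q} → p ≢ q → degree G p ≡ 3 → degree G q ≡ 3 →
    (F : Subset (#E G)) → 3 ≤ ∣ F ∣ → (∀ e → e ∈ F → Incident G p e × Incident G q e) →
    IsK23 G
  pair⇒K23 {p} {q} p≢q dp dq F 3≤∣F∣ F-joins = from-cut (cut (pair p q))
    where
    t : ℕ
    t = count (meets (pair p q))
    t≤3 : t ≤ 3
    t≤3 = +-cancelʳ-≤ 3 t 3 (≤-trans (+-monoʳ-≤ t 3≤∣F∣)
            (subst₂ (λ a b → t + ∣ F ∣ ≤ a + b) dp dq (meets-pair+joins≤degrees F F-joins)))
    two-in-pair : 2 ≤ count (pair p q)
    two-in-pair = count-two (pair p q) p≢q (cong (_∨ ⌊ p ≟ q ⌋) (≟-refl p))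
                    (trans (cong (⌊ q ≟ p ⌋ ∨_) (≟-refl q)) (Bool.∨-zeroʳ ⌊ q ≟ p ⌋))
    two-vertices : 2 ≤ n G
    two-vertices = subst (2 ≤_) (count-all (λ _ → true) (λ _ → refl)) (count-two (λ _ → true) p≢q refl refl)
    from-cut : (2 * count (pair p q) ≤ t) ⊎ (t ≡ #E G) → IsK23 G
    from-cut (inj₁ many) = ⊥-elim (4≰3 (≤-trans (*-monoʳ-≤ 2 two-in-pair) (≤-trans many t≤3)))
      where
      4≰3 : ¬ (4 ≤ 3)
      4≰3 (s≤s (s≤s (s≤s ())))
    from-cut (inj₂ t≡m) = N≡2 , m≡3 , loop-free
      where
      m≤3 : #E G ≤ 3
      m≤3 = subst (_≤ 3) t≡m t≤3
      N≡2 : n G ≡ 2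
      N≡2 = ≤-antisym (*-cancelˡ-≤ 2 (subst (_≤ 4) #edges (+-monoˡ-≤ 1 m≤3))) two-vertices
      m≡3 : #E G ≡ 3
      m≡3 = +-cancelʳ-≡ 1 (#E G) 3 (trans #edges (cong (2 *_) N≡2))
      F≡⊤ : F ≡ ⊤
      F≡⊤ = ∣p∣≡n⇒p≡⊤ (≤-antisym (∣p∣≤n F) (subst (_≤ ∣ F ∣) (sym m≡3) 3≤∣F∣))
      loop-free : ∀ e → proj₁ (endpoints G e) ≢ proj₂ (endpoints G e)
      loop-free e a≡b with F-joins e (subst (e ∈_) (sym F≡⊤) ∈⊤)
      ... | at-p , at-q = p≢q (trans (sym (loop-end a≡b at-p)) (loop-end a≡b at-q))
        where
        loop-end : ∀ {a b v : Vertex G} → a ≡ b → (a ≡ v) ⊎ (b ≡ v) → a ≡ v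
        loop-end _ (inj₁ a≡v) = a≡v
        loop-end a≡b (inj₂ b≡v) = trans a≡b b≡v

  edge-missing-pair : ∀ {p q} → ¬ IsK23 G → p ≢ q → degree G p ≡ 3 → degree G q ≡ 3 →
    (F : Subset (#E G)) → 3 ≤ ∣ F ∣ →
    Σ (Edge G) (λ e → e ∈ F × (¬ Incident G p e ⊎ ¬ Incident G q e))
  edge-missing-pair {p} {q} not-K23 p≢q dp dq F 3≤∣F∣
    with any? (λ e → (e ∈? F) ×-dec (¬? (incident? G p e) ⊎-dec ¬? (incident? G q e)))
  ... | yes found = found
  ... | no none = ⊥-elim (not-K23 (pair⇒K23 p≢q dp dq F 3≤∣F∣ joins))
    where
    joins : ∀ e → e ∈ F → Incident G p e × Incident G q e
    joins e e∈F = decidable-stable (incident? G p e) (λ ¬i → none (e , e∈F , inj₁ ¬i)) ,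
                  decidable-stable (incident? G q e) (λ ¬i → none (e , e∈F , inj₂ ¬i))

  -- A tight subgraph: a subgraph with an edge and |E'| = 2|V'| - 1 edges (the
  -- upper bound being sparsity).
  TightSubgraph : Subset (n G) → Subset (#E G) → Set
  TightSubgraph V E = IsSubgraph G V E × Nonempty E × (2 * ∣ V ∣ ≤ ∣ E ∣ + 1)

  tight? : ∀ V E → Dec (TightSubgraph V E)
  tight? V E = all? (λ e → (e ∈? E) →-dec ((proj₁ (endpoints G e) ∈? V) ×-dec (proj₂ (endpoints G e) ∈? V)))
               ×-dec (nonempty? E ×-dec (2 * ∣ V ∣ ≤? ∣ E ∣ + 1))

  whole-tight : Edge G → TightSubgraph ⊤ ⊤
  whole-tight e = (λ _ _ → ∈⊤ , ∈⊤) , (e , ∈⊤) , ≤-reflexive (begin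
      2 * ∣ ⊤ {n G} ∣   ≡⟨ cong (2 *_) (∣⊤∣≡n (n G)) ⟩
      2 * n G           ≡⟨ #edges ⟨
      #E G + 1          ≡⟨ cong (_+ 1) (∣⊤∣≡n (#E G)) ⟨
      ∣ ⊤ {#E G} ∣ + 1  ∎)
    where open ≡-Reasoning

  tight⇒3-edges : ∀ {V E p q} → TightSubgraph V E → p ∈ V → q ∈ V → p ≢ q → 3 ≤ ∣ E ∣
  tight⇒3-edges {V} {E} (_ , _ , dense) p∈V q∈V p≢q = ≤-pred (begin
      4              ≤⟨ *-monoʳ-≤ 2 (subst (2 ≤_) (sym (∣∣-count V)) (count-two (V !_) p≢q (∈⇒! p∈V) (∈⇒! q∈V))) ⟩
      2 * ∣ V ∣      ≤⟨ dense ⟩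
      ∣ E ∣ + 1      ≡⟨ +-comm ∣ E ∣ 1 ⟩
      suc ∣ E ∣      ∎)
    where open ≤-Reasoning

  -- Submodularity: two tight subgraphs sharing an edge meet in a tight
  -- subgraph, since their union is sparse and counts are modular.
  tight-∩ : ∀ {V₁ E₁ V₂ E₂ e} → TightSubgraph V₁ E₁ → TightSubgraph V₂ E₂ → e ∈ E₁ → e ∈ E₂ →
    TightSubgraph (V₁ ∩ V₂) (E₁ ∩ E₂)
  tight-∩ {V₁} {E₁} {V₂} {E₂} {e} (sub₁ , _ , dense₁) (sub₂ , _ , dense₂) e∈₁ e∈₂ =
    sub-∩ , (e , x∈p∩q⁺ (e∈₁ , e∈₂)) , dense-∩
    where
    sub-∩ : IsSubgraph G (V₁ ∩ V₂) (E₁ ∩ E₂)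
    sub-∩ k k∈ with x∈p∩q⁻ E₁ E₂ k∈
    ... | k∈₁ , k∈₂ = x∈p∩q⁺ (proj₁ (sub₁ k k∈₁) , proj₁ (sub₂ k k∈₂)) ,
                      x∈p∩q⁺ (proj₂ (sub₁ k k∈₁) , proj₂ (sub₂ k k∈₂))
    sub-∪ : IsSubgraph G (V₁ ∪ V₂) (E₁ ∪ E₂)
    sub-∪ k k∈ with x∈p∪q⁻ E₁ E₂ k∈
    ... | inj₁ k∈₁ = x∈p∪q⁺ (inj₁ (proj₁ (sub₁ k k∈₁))) , x∈p∪q⁺ (inj₁ (proj₂ (sub₁ k k∈₁)))
    ... | inj₂ k∈₂ = x∈p∪q⁺ (inj₂ (proj₁ (sub₂ k k∈₂))) , x∈p∪q⁺ (inj₂ (proj₂ (sub₂ k k∈₂)))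
    sparse-∪ : ∣ E₁ ∪ E₂ ∣ + 1 ≤ 2 * ∣ V₁ ∪ V₂ ∣
    sparse-∪ = sparse (V₁ ∪ V₂) (E₁ ∪ E₂) sub-∪ (e , x∈p∪q⁺ (inj₁ e∈₁))
    dense-∩ : 2 * ∣ V₁ ∩ V₂ ∣ ≤ ∣ E₁ ∩ E₂ ∣ + 1
    dense-∩ = submodular-count {c = ∣ V₁ ∣} {d = ∣ V₂ ∣} {U = ∣ V₁ ∪ V₂ ∣} {I = ∣ V₁ ∩ V₂ ∣}
                dense₁ dense₂ sparse-∪ (∣∪∣+∣∩∣ E₁ E₂) (∣∪∣+∣∩∣ V₁ V₂)

  module Removable (e₀ : Edge G) (tight₀ : Tight 2 2 (G -ₑ e₀)) where

    -- Every tight subgraph contains e₀: otherwise it is a subgraph of G - e₀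
    -- with 2|V'| - 1 edges, against (2,2)-sparsity.
    tight⇒e₀ : ∀ {V E} → TightSubgraph V E → e₀ ∈ E
    tight⇒e₀ {V} {E} (sub , (k , k∈E) , dense) with e₀ ∈? E
    ... | yes e₀∈E = e₀∈E
    ... | no e₀∉E = ⊥-elim (2≰1 (+-cancelˡ-≤ ∣ E ∣ 2 1 (≤-trans sparse₀ dense)))
      where
      open EdgeDeletion G e₀
      sparse₀ : ∣ E ∣ + 2 ≤ 2 * ∣ V ∣
      sparse₀ = subst (λ c → c + 2 ≤ 2 * ∣ V ∣) (∣restrict∣ (edges G) e₀ E (∉⇒! e₀∉E))
                  (proj₁ tight₀ V (restrict (edges G) e₀ E) (subgraph-restrict V E sub)
                     (nonempty-restrict E k k∈E (λ k≡e₀ → e₀∉E (subst (_∈ E) k≡e₀ k∈E))))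

    record MinimalTight : Set where
      field
        V : Subset (n G)
        E : Subset (#E G)
        tight : TightSubgraph V E
        minimal : ∀ {V′ E′} → TightSubgraph V′ E′ → ∣ E ∣ ≤ ∣ E′ ∣

    minimal-tight : MinimalTight
    minimal-tight =
      let (V , E) , tight , least = minimise (λ VE → TightSubgraph (proj₁ VE) (proj₂ VE)) (∣_∣ ∘ proj₂)
                                      smaller? (⊤ , ⊤) (whole-tight e₀)
      in record { V = V ; E = E ; tight = tight ; minimal = least _ }
      where
      smaller? : ∀ k → Dec (Σ (Subset (n G) × Subset (#E G)) λ VE →
                   TightSubgraph (proj₁ VE) (proj₂ VE) × ∣ proj₂ VE ∣ < k)
      smaller? k = map′ (λ (V , E , t) → (V , E) , t) (λ ((V , E) , t) → V , E , t)
                     (anySubset? (λ V → anySubset? (λ E → tight? V E ×-dec (∣ E ∣ <? k))))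

    -- Every edge e of a minimal tight subgraph H can be removed: a subgraph of
    -- G - e violating (2,2)-sparsity would be a tight subgraph of G avoiding e,
    -- and its intersection with H (both contain e₀) a tight subgraph smaller than H.
    removable : (H : MinimalTight) → ∀ e → e ∈ MinimalTight.E H → Tight 2 2 (G -ₑ e)
    removable H e e∈H = sparse₂₂ , count₂₂
      where
      open MinimalTight H
      open EdgeDeletion G e
      count₂₂ : #E (G -ₑ e) + 2 ≡ 2 * n G
      count₂₂ = trans (+-suc (#E (G -ₑ e)) 1)
                  (trans (cong (_+ 1) (sym (length-removeAt′ (edges G) e))) #edges)
      sparse₂₂ : Sparse 2 2 (G -ₑ e)
      sparse₂₂ V′ E′ sub nonempty with ∣ E′ ∣ + 2 ≤? 2 * ∣ V′ ∣
      ... | yes sparse′ = sparse′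
      ... | no dense′ = ⊥-elim (<⇒≱ smaller (minimal (tight-∩ tight lifted e₀∈H e₀∈lifted)))
        where
        E″ : Subset (#E G)
        E″ = extend (edges G) e E′
        lifted : TightSubgraph V′ E″
        lifted = subgraph-extend V′ E′ sub , nonempty-extend E′ nonempty ,
                 subst (λ c → 2 * ∣ V′ ∣ ≤ c + 1) (sym (∣extend∣ (edges G) e E′))
                   (≤-pred (subst (2 * ∣ V′ ∣ <_) (+-suc ∣ E′ ∣ 1) (≰⇒> dense′)))
        e₀∈H : e₀ ∈ E
        e₀∈H = tight⇒e₀ tight
        e₀∈lifted : e₀ ∈ E″
        e₀∈lifted = tight⇒e₀ lifted
        smaller : ∣ E ∩ E″ ∣ < ∣ E ∣
        smaller = p⊂q⇒∣p∣<∣q∣ (p∩q⊆p E E″ , e , e∈H , λ e∈∩ →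
                    true≢false (trans (sym (∈⇒! (proj₂ (x∈p∩q⁻ E E″ e∈∩)))) (extend-deleted (edges G) e E′)))

lemma5p7 : (G : Graph) → P21 G → ¬ IsK23 G → (∀ v → degree G v ≢ 2) →
    Σ (Vertex G) (λ v → (degree G v ≡ 3) ×
    Σ (Edge G) (λ e → ¬ Incident G v e × Tight 2 2 (G -ₑ e)))
lemma5p7 G ((sparse , #edges) , e₀ , tight₀) not-K23 no-degree-2 =
  conclude (degree-3-beside degree≥3 p q)
  where
  open TightGraph G sparse #edges
  open Removable e₀ tight₀
  open MinimalTight minimal-tight
  degree≥3 : ∀ v → 3 ≤ degree G v
  degree≥3 v = ≤∧≢⇒< (degree≥2 v) (no-degree-2 v ∘ sym)
  f : Edge G
  f = proj₁ (proj₁ (proj₂ tight))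
  f∈H : f ∈ E
  f∈H = proj₂ (proj₁ (proj₂ tight))
  p q : Vertex G
  p = proj₁ (endpoints G f)
  q = proj₂ (endpoints G f)
  Result : Set
  Result = Σ (Vertex G) (λ v → (degree G v ≡ 3) × Σ (Edge G) (λ e → ¬ Incident G v e × Tight 2 2 (G -ₑ e)))
  conclude : Σ (Vertex G) (λ v → v ≢ p × v ≢ q × degree G v ≡ 3) ⊎ (p ≢ q × degree G p ≡ 3 × degree G q ≡ 3) →
    Result
  conclude (inj₁ (v , v≢p , v≢q , dv)) = v , dv , f , [ v≢p ∘ sym , v≢q ∘ sym ] , removable minimal-tight f f∈H
  conclude (inj₂ (p≢q , dp , dq))
    with edge-missing-pair not-K23 p≢q dp dq E
           (tight⇒3-edges tight (proj₁ (proj₁ tight f f∈H)) (proj₂ (proj₁ tight f f∈H)) p≢q)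
  ... | e , e∈H , inj₁ e-misses-p = p , dp , e , e-misses-p , removable minimal-tight e e∈H
  ... | e , e∈H , inj₂ e-misses-q = q , dq , e , e-misses-q , removable minimal-tight e e∈H
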